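{- Let $R=\{1,\omega,\omega^*,\zeta\}$ and for linear orders $L,M$ let $L\cdot_F M=\operatorname{o.t.}\big((LM)/\!\sim_F\big)$. Then $(R,\cdot_F)$ is a left regular band: $\cdot_F$ is an associative operation on $R$ (up to order isomorphism) under which $R$ is closed, every $X\in R$ satisfies $X\cdot_F X\cong X$, and $X\cdot_F Y\cdot_F X\cong X\cdot_F Y$ for all $X,Y\in R$.
   Context: $\omega$ is the order type of $\mathbb N$, $\omega^*$ the order type of the negative integers (reverse of $\mathbb N$), $\zeta$ the order type of $\mathbb Z$, and $1$ the one-point order. For a linear order $L$ and $x,y\in L$, write $x\sim_F y$ iff the set of points of $L$ lying (weakly) between $x$ and $y$ is finite; this is an equivalence relation whose classes are intervals, and $L/\!\sim_F$ denotes the set of classes with the order induced from $L$. The product $LM$ of linear orders is the lexicographic order on $L\times M$: $(l,m)<(l',m')$ iff $l<l'$, or $l=l'$ and $m<m'$ (i.e. each point of $L$ is replaced by a copy of $M$). $\operatorname{o.t.}$ denotes order type. A left regular band is a semigroup in which every element is idempotent and $xyx=xy$ for all $x,y$. -}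

module Defs where

open import Level using (0ℓ)
open import Data.Empty using (⊥)
open import Data.Unit using (⊤; tt)
open import Data.Product using (Σ; _×_; _,_)
open import Data.Sum using (_⊎_; inj₁; inj₂)
open import Data.List using (List)
open import Data.List.Membership.Propositional using (_∈_)
open import Function.Bundles using (_⇔_)
open import Relation.Nullary using (¬_)
open import Relation.Binary.Core using (Rel)
open import Relation.Binary.Structures using (IsStrictTotalOrder; IsStrictPartialOrder)
open import Relation.Binary.Definitions using (tri≈)
open import Relation.Binary.PropositionalEquality using (_≡_; refl; isEquivalence; resp₂)
import Data.Nat as ℕ
import Data.Nat.Properties as ℕP
import Data.Integer as ℤ
import Data.Integer.Properties as ℤP
import Relation.Binary.Construct.Flip.EqAndOrd as Flip

record LinOrder : Set₁ where
  field
    Carrier : Set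
    _<_     : Rel Carrier 0ℓ
    isSTO   : IsStrictTotalOrder _≡_ _<_

open LinOrder public using (Carrier)

⊤-isSTO : IsStrictTotalOrder {A = ⊤} _≡_ (λ _ _ → ⊥)
⊤-isSTO = record
  { isStrictPartialOrder = record
    { isEquivalence = isEquivalence
    ; irrefl        = λ _ ()
    ; trans         = λ ()
    ; <-resp-≈      = (λ { refl p → p }) , (λ { refl p → p })
    }
  ; compare = λ { tt tt → tri≈ (λ ()) refl (λ ()) }
  }

𝟙 : LinOrder
𝟙 = record { Carrier = ⊤ ; _<_ = λ _ _ → ⊥ ; isSTO = ⊤-isSTO }

ω : LinOrder
ω = record { Carrier = ℕ.ℕ ; _<_ = ℕ._<_ ; isSTO = ℕP.<-isStrictTotalOrder }

ω* : LinOrder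
ω* = record { Carrier = ℕ.ℕ ; _<_ = λ m n → n ℕ.< m
            ; isSTO = Flip.isStrictTotalOrder ℕP.<-isStrictTotalOrder }

ζ : LinOrder
ζ = record { Carrier = ℤ.ℤ ; _<_ = ℤ._<_ ; isSTO = ℤP.<-isStrictTotalOrder }

data R : Set where
  one omega omegaStar zeta : R

⟦_⟧ : R → LinOrder
⟦ one ⟧       = 𝟙
⟦ omega ⟧     = ω
⟦ omegaStar ⟧ = ω*
⟦ zeta ⟧      = ζ

module Product (L M : LinOrder) where
  private
    module L = LinOrder L
    module M = LinOrder M

  P : Set
  P = L.Carrier × M.Carrier

  _<ₚ_ : Rel P 0ℓ
  (l , m) <ₚ (l′ , m′) = (l L.< l′) ⊎ ((l ≡ l′) × (m M.< m′))

  _≤ₚ_ : Rel P 0ℓ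
  p ≤ₚ q = (p <ₚ q) ⊎ (p ≡ q)

  Between : P → P → P → Set
  Between x y z = ((x ≤ₚ z) × (z ≤ₚ y)) ⊎ ((y ≤ₚ z) × (z ≤ₚ x))

  _∼F_ : Rel P 0ℓ
  x ∼F y = Σ (List P) λ xs → ∀ z → Between x y z → z ∈ xs

  -- (LM)/∼F is order-isomorphic to T: there is a map f from LM onto T
  -- whose fibres are exactly the ∼F-classes and which sends the induced
  -- order on classes ([x] < [y] iff x < y and x ≁F y) to the order of T.
  -- This is precisely an order isomorphism (LM)/∼F ≅ T.
  QuotientIso : LinOrder → Set
  QuotientIso T =
    Σ (P → Carrier T) λ f →
        (∀ t → Σ P λ p → f p ≡ t)
      × (∀ p q → (f p ≡ f q) ⇔ (p ∼F q))
      × (∀ p q → p <ₚ q → ¬ (p ∼F q) → LinOrder._<_ T (f p) (f q))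

_·F_≅_ : LinOrder → LinOrder → LinOrder → Set
L ·F M ≅ T = Product.QuotientIso L M T

_≅_ : LinOrder → LinOrder → Set
A ≅ B =
  Σ (Carrier A → Carrier B) λ f →
  Σ (Carrier B → Carrier A) λ g →
      (∀ a → g (f a) ≡ a)
    × (∀ b → f (g b) ≡ b)
    × (∀ x y → LinOrder._<_ A x y ⇔ LinOrder._<_ B (f x) (f y))

-- If M is locally finite and infinite towards one end, two points of LM are ∼F exactly
-- when they lie in the same copy of M, so (LM)/∼F ≅ L; if instead one factor is 1 and
-- the other locally finite, all of LM is one class.  Hence X ·F Y is 1 when X or Y is 1
-- and X otherwise: 1 is a zero adjoined to the left-zero band {ω, ω*, ζ}.  Since the
-- quotient is unique up to isomorphism and the four orders are told apart by whether
-- they have a least and a greatest element, every hypothesis X ·F Y ≅ Z pins Z down to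
-- this table, and the band laws become identities of the table.
module Submission where

open import Defs
open import Function using (_∘_; id)
open import Function.Bundles using (_⇔_; mk⇔; Equivalence)
open import Function.Construct.Symmetry using (⇔-sym)
open import Function.Construct.Composition using (_⇔-∘_)
open import Data.Empty using (⊥-elim)
open import Data.Unit using (tt)
open import Data.Bool as Bool using (Bool; true; false)
open import Data.Product using (Σ; _×_; _,_; proj₁; proj₂)
open import Data.Product.Properties using (≡-dec)
open import Data.Product.Relation.Binary.Lex.Strict using (×-compare)
open import Data.Product.Relation.Binary.Pointwise.NonDependent using (≡×≡⇒≡)
open import Data.Sum as Sum using (_⊎_; inj₁; inj₂; [_,_]′)
open import Data.List using (List; []; _∷_; map; upTo; _++_)
open import Data.List.Extrema.Nat using (max; ⊥≤max; xs≤max)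
open import Data.List.Membership.Propositional using (_∈_; _∉_)
open import Data.List.Membership.Propositional.Properties using (∈-map⁺; ∈-++⁺ˡ; ∈-++⁺ʳ; ∈-upTo⁺)
open import Data.List.Relation.Unary.All as All using ()
open import Data.List.Relation.Unary.Any using (here)
open import Relation.Nullary using (¬_; Dec; yes; no; does)
open import Relation.Nullary.Decidable using (map′; _×-dec_; does-⇔; toWitness)
open import Relation.Binary.Definitions using (DecidableEquality; tri<; tri≈; tri>)
open import Relation.Binary.Structures using (IsStrictTotalOrder)
open import Relation.Binary.PropositionalEquality
  using (_≡_; refl; sym; cong; cong₂; subst; subst₂; isEquivalence; module ≡-Reasoning)
open import Algebra.Definitions {A = R} _≡_ using (Associative; Idempotent)
import Relation.Binary.Construct.StrictToNonStrict as StrictToNonStrict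
import Data.Nat as ℕ
import Data.Nat.Properties as ℕP
import Data.Integer as ℤ
open ℕ using (ℕ; suc; s≤s)
open ℤ using (ℤ; +_; -[1+_]; ∣_∣; -≤-; +≤+; -<-; -<+; +<+)
open Equivalence using (to; from)

module Order (A : LinOrder) where
  open LinOrder A public using (_<_)
  open IsStrictTotalOrder (LinOrder.isSTO A) public
    using (compare; irrefl; asym) renaming (trans to <-trans)
  open StrictToNonStrict {A = Carrier A} _≡_ _<_ public using (_≤_)

  ≤-antisym : ∀ {a b} → a ≤ b → b ≤ a → a ≡ b
  ≤-antisym = StrictToNonStrict.antisym _≡_ _<_ isEquivalence <-trans irrefl

  Between : Carrier A → Carrier A → Carrier A → Set
  Between a b c = (a ≤ c × c ≤ b) ⊎ (b ≤ c × c ≤ a)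

module _ (A : LinOrder) where
  open Order A

  LocallyFinite : Set
  LocallyFinite = ∀ a b → Σ (List (Carrier A)) λ xs → ∀ c → Between a b c → c ∈ xs

  InfiniteAbove InfiniteBelow : Set
  InfiniteAbove = ∀ a (xs : List (Carrier A)) → Σ (Carrier A) λ c → a ≤ c × c ∉ xs
  InfiniteBelow = ∀ a (xs : List (Carrier A)) → Σ (Carrier A) λ c → c ≤ a × c ∉ xs

  HasMin HasMax : Set
  HasMin = Σ (Carrier A) λ a → ∀ b → ¬ (b < a)
  HasMax = Σ (Carrier A) λ a → ∀ b → ¬ (a < b)

≅-refl : ∀ {A} → A ≅ A
≅-refl = id , id , (λ _ → refl) , (λ _ → refl) , λ _ _ → mk⇔ id id

≅-sym : ∀ {A B} → A ≅ B → B ≅ A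
≅-sym {A} {B} (f , g , g∘f , f∘g , f-<) = g , f , f∘g , g∘f , λ b b′ → mk⇔
  (λ b<b′ → from (f-< (g b) (g b′)) (subst₂ B._<_ (sym (f∘g b)) (sym (f∘g b′)) b<b′))
  (λ gb<gb′ → subst₂ B._<_ (f∘g b) (f∘g b′) (to (f-< (g b) (g b′)) gb<gb′))
  where module B = Order B

≅-HasMin : ∀ {A B} → A ≅ B → HasMin A → HasMin B
≅-HasMin {A} {B} (f , g , _ , f∘g , f-<) (a , a-min) = f a , λ b b<fa →
  a-min (g b) (from (f-< (g b) a) (subst (B._< f a) (sym (f∘g b)) b<fa))
  where module B = Order B

≅-HasMax : ∀ {A B} → A ≅ B → HasMax A → HasMax B
≅-HasMax {A} {B} (f , g , _ , f∘g , f-<) (a , a-max) = f a , λ b fa<b →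
  a-max (g b) (from (f-< a (g b)) (subst (f a B.<_) (sym (f∘g b)) fa<b))
  where module B = Order B

HasMin-cong : ∀ {A B} → A ≅ B → HasMin A ⇔ HasMin B
HasMin-cong {A} {B} A≅B = mk⇔ (≅-HasMin {A} {B} A≅B) (≅-HasMin {B} {A} (≅-sym {A} {B} A≅B))

HasMax-cong : ∀ {A B} → A ≅ B → HasMax A ⇔ HasMax B
HasMax-cong {A} {B} A≅B = mk⇔ (≅-HasMax {A} {B} A≅B) (≅-HasMax {B} {A} (≅-sym {A} {B} A≅B))

≤ω⇒≤ : ∀ {m n} → Order._≤_ ω m n → m ℕ.≤ n
≤ω⇒≤ = [ ℕP.<⇒≤ , ℕP.≤-reflexive ]′

≤ω*⇒≥ : ∀ {m n} → Order._≤_ ω* m n → n ℕ.≤ m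
≤ω*⇒≥ = [ ℕP.<⇒≤ , ℕP.≤-reflexive ∘ sym ]′

≤ζ⇒≤ : ∀ {i j} → Order._≤_ ζ i j → i ℤ.≤ j
≤ζ⇒≤ = [ ℤP.<⇒≤ , ℤP.≤-reflexive ]′
  where import Data.Integer.Properties as ℤP

locallyFinite-𝟙 : LocallyFinite 𝟙
locallyFinite-𝟙 _ _ = tt ∷ [] , λ _ _ → here refl

locallyFinite-ω : LocallyFinite ω
locallyFinite-ω a b = upTo (suc (a ℕ.+ b)) , λ
  { c (inj₁ (_ , c≤b)) → ∈-upTo⁺ (s≤s (ℕP.m≤n⇒m≤o+n a (≤ω⇒≤ c≤b)))
  ; c (inj₂ (_ , c≤a)) → ∈-upTo⁺ (s≤s (ℕP.m≤n⇒m≤n+o b (≤ω⇒≤ c≤a))) }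

locallyFinite-ω* : LocallyFinite ω*
locallyFinite-ω* a b = upTo (suc (a ℕ.+ b)) , λ
  { c (inj₁ (a≥c , _)) → ∈-upTo⁺ (s≤s (ℕP.m≤n⇒m≤n+o b (≤ω*⇒≥ a≥c)))
  ; c (inj₂ (b≥c , _)) → ∈-upTo⁺ (s≤s (ℕP.m≤n⇒m≤o+n a (≤ω*⇒≥ b≥c))) }

∣c∣≤∣a∣+∣b∣ : ∀ {a b c} → a ℤ.≤ c → c ℤ.≤ b → ∣ c ∣ ℕ.≤ ∣ a ∣ ℕ.+ ∣ b ∣
∣c∣≤∣a∣+∣b∣ {a} {+ _} {+ _} _ (+≤+ n≤k) = ℕP.m≤n⇒m≤o+n ∣ a ∣ n≤k
∣c∣≤∣a∣+∣b∣ { -[1+ _ ]} {b} { -[1+ _ ]} (-≤- n≤k) _ = s≤s (ℕP.m≤n⇒m≤n+o ∣ b ∣ n≤k)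

symmetricRange : ℕ → List ℤ
symmetricRange n = map +_ (upTo n) ++ map -[1+_] (upTo n)

∣i∣<n⇒∈symmetricRange : ∀ {i n} → ∣ i ∣ ℕ.< n → i ∈ symmetricRange n
∣i∣<n⇒∈symmetricRange {+ _} k<n = ∈-++⁺ˡ (∈-map⁺ +_ (∈-upTo⁺ k<n))
∣i∣<n⇒∈symmetricRange { -[1+ _ ]} {n} 1+k<n =
  ∈-++⁺ʳ (map +_ (upTo n)) (∈-map⁺ -[1+_] (∈-upTo⁺ (ℕP.<⇒≤ 1+k<n)))

locallyFinite-ζ : LocallyFinite ζ
locallyFinite-ζ a b = symmetricRange (suc (∣ a ∣ ℕ.+ ∣ b ∣)) , λ
  { c (inj₁ (a≤c , c≤b)) → ∣i∣<n⇒∈symmetricRange (s≤s (∣c∣≤∣a∣+∣b∣ (≤ζ⇒≤ a≤c) (≤ζ⇒≤ c≤b)))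
  ; c (inj₂ (b≤c , c≤a)) → ∣i∣<n⇒∈symmetricRange (s≤s (ℕP.≤-trans
      (∣c∣≤∣a∣+∣b∣ (≤ζ⇒≤ b≤c) (≤ζ⇒≤ c≤a)) (ℕP.≤-reflexive (ℕP.+-comm ∣ b ∣ ∣ a ∣)))) }

fresh-ℕ : ∀ n (xs : List ℕ) → Σ ℕ λ k → n ℕ.< k × k ∉ xs
fresh-ℕ n xs = suc (max n xs) , s≤s (⊥≤max n xs) ,
  λ k∈xs → ℕP.<-irrefl refl (All.lookup (xs≤max n xs) k∈xs)

infiniteAbove-ω : InfiniteAbove ω
infiniteAbove-ω n xs with fresh-ℕ n xs
... | k , n<k , k∉xs = k , inj₁ n<k , k∉xs

infiniteBelow-ω* : InfiniteBelow ω*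
infiniteBelow-ω* n xs with fresh-ℕ n xs
... | k , n<k , k∉xs = k , inj₁ n<k , k∉xs

∣i∣<n⇒i<+n : ∀ {i n} → ∣ i ∣ ℕ.< n → i ℤ.< + n
∣i∣<n⇒i<+n {+ _} k<n = +<+ k<n
∣i∣<n⇒i<+n { -[1+ _ ]} _ = -<+

infiniteAbove-ζ : InfiniteAbove ζ
infiniteAbove-ζ i xs with fresh-ℕ ∣ i ∣ (map ∣_∣ xs)
... | k , ∣i∣<k , k∉∣xs∣ = + k , inj₁ (∣i∣<n⇒i<+n ∣i∣<k) , k∉∣xs∣ ∘ ∈-map⁺ ∣_∣

min-𝟙 : HasMin 𝟙
min-𝟙 = tt , λ _ ()

max-𝟙 : HasMax 𝟙
max-𝟙 = tt , λ _ ()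

min-ω : HasMin ω
min-ω = 0 , λ _ ()

noMax-ω : ¬ HasMax ω
noMax-ω (n , n-max) = n-max (suc n) (ℕP.n<1+n n)

max-ω* : HasMax ω*
max-ω* = 0 , λ _ ()

noMin-ω* : ¬ HasMin ω*
noMin-ω* (n , n-min) = n-min (suc n) (ℕP.n<1+n n)

noMin-ζ : ¬ HasMin ζ
noMin-ζ (+ n , i-min) = i-min -[1+ 0 ] -<+
noMin-ζ (-[1+ n ] , i-min) = i-min -[1+ suc n ] (-<- (ℕP.n<1+n n))

noMax-ζ : ¬ HasMax ζ
noMax-ζ (+ n , i-max) = i-max (+ suc n) (+<+ (ℕP.n<1+n n))
noMax-ζ (-[1+ n ] , i-max) = i-max (+ 0) -<+

module Lex (L M : LinOrder) where
  open Product L M public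
  private
    module L = Order L
    module M = Order M

  compareₚ : ∀ p q → p <ₚ q ⊎ p ≡ q ⊎ q <ₚ p
  compareₚ p q with ×-compare sym L.compare M.compare p q
  ... | tri< p<q _ _ = inj₁ p<q
  ... | tri≈ _ p≈q _ = inj₂ (inj₁ (≡×≡⇒≡ p≈q))
  ... | tri> _ _ q<p = inj₂ (inj₂ q<p)

  ∼F-sym : ∀ {p q} → p ∼F q → q ∼F p
  ∼F-sym (xs , covers) = xs , λ z → covers z ∘ Sum.swap

  ≤ₚ⇒≤₁ : ∀ {l m l′ m′} → (l , m) ≤ₚ (l′ , m′) → l L.≤ l′
  ≤ₚ⇒≤₁ (inj₁ (inj₁ l<l′)) = inj₁ l<l′
  ≤ₚ⇒≤₁ (inj₁ (inj₂ (l≡l′ , _))) = inj₂ l≡l′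
  ≤ₚ⇒≤₁ (inj₂ refl) = inj₂ refl

  ≤ₚ⇒≤₂ : ∀ {l m m′} → (l , m) ≤ₚ (l , m′) → m M.≤ m′
  ≤ₚ⇒≤₂ (inj₁ (inj₁ l<l)) = ⊥-elim (L.irrefl refl l<l)
  ≤ₚ⇒≤₂ (inj₁ (inj₂ (_ , m<m′))) = inj₁ m<m′
  ≤ₚ⇒≤₂ (inj₂ refl) = inj₂ refl

  ≤₂⇒≤ₚ : ∀ {l m m′} → m M.≤ m′ → (l , m) ≤ₚ (l , m′)
  ≤₂⇒≤ₚ (inj₁ m<m′) = inj₁ (inj₂ (refl , m<m′))
  ≤₂⇒≤ₚ (inj₂ refl) = inj₂ refl

  Between-column : ∀ {l m m′ k n} → Between (l , m) (l , m′) (k , n) → k ≡ l × M.Between m m′ n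
  Between-column (inj₁ (p , q)) with L.≤-antisym (≤ₚ⇒≤₁ q) (≤ₚ⇒≤₁ p)
  ... | refl = refl , inj₁ (≤ₚ⇒≤₂ p , ≤ₚ⇒≤₂ q)
  Between-column (inj₂ (p , q)) with L.≤-antisym (≤ₚ⇒≤₁ q) (≤ₚ⇒≤₁ p)
  ... | refl = refl , inj₂ (≤ₚ⇒≤₂ p , ≤ₚ⇒≤₂ q)

  ∼F-column : LocallyFinite M → ∀ l m m′ → (l , m) ∼F (l , m′)
  ∼F-column fin l m m′ with fin m m′
  ... | xs , covers = map (l ,_) xs , covers-column
    where
    covers-column : ∀ z → Between (l , m) (l , m′) z → z ∈ map (l ,_) xs
    covers-column (k , n) between with Between-column between
    ... | refl , n-between = ∈-map⁺ (l ,_) (covers n n-between)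

  -- Everything in the copy of M over l above m (or over l′ below m′) lies between the two points.
  ≁F-across : InfiniteAbove M ⊎ InfiniteBelow M →
              ∀ {l l′ m m′} → l L.< l′ → ¬ (l , m) ∼F (l′ , m′)
  ≁F-across (inj₁ above) {l} {m = m} l<l′ (xs , covers) with above m (map proj₂ xs)
  ... | n , m≤n , n∉ =
    n∉ (∈-map⁺ proj₂ (covers (l , n) (inj₁ (≤₂⇒≤ₚ m≤n , inj₁ (inj₁ l<l′)))))
  ≁F-across (inj₂ below) {l′ = l′} {m′ = m′} l<l′ (xs , covers) with below m′ (map proj₂ xs)
  ... | n , n≤m′ , n∉ =
    n∉ (∈-map⁺ proj₂ (covers (l′ , n) (inj₁ (inj₁ (inj₁ l<l′) , ≤₂⇒≤ₚ n≤m′))))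

  quotientIso-𝟙 : P → (∀ p q → p ∼F q) → QuotientIso 𝟙
  quotientIso-𝟙 p₀ all∼F = (λ _ → tt) , (λ _ → p₀ , refl) ,
    (λ p q → mk⇔ (λ _ → all∼F p q) (λ _ → refl)) , λ p q _ p≁q → ⊥-elim (p≁q (all∼F p q))

  quotientIso-left : LocallyFinite M → InfiniteAbove M ⊎ InfiniteBelow M → Carrier M → QuotientIso L
  quotientIso-left fin infinite m₀ = proj₁ , (λ l → (l , m₀) , refl) , fibres , monotone
    where
    fibres : ∀ p q → (proj₁ p ≡ proj₁ q) ⇔ (p ∼F q)
    fibres (l , m) (l′ , m′) = mk⇔ (λ { refl → ∼F-column fin l m m′ }) same-column
      where
      same-column : (l , m) ∼F (l′ , m′) → l ≡ l′
      same-column p∼q with L.compare l l′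
      ... | tri< l<l′ _ _ = ⊥-elim (≁F-across infinite l<l′ p∼q)
      ... | tri≈ _ l≡l′ _ = l≡l′
      ... | tri> _ _ l′<l = ⊥-elim (≁F-across infinite l′<l (∼F-sym p∼q))

    monotone : ∀ p q → p <ₚ q → ¬ p ∼F q → proj₁ p L.< proj₁ q
    monotone _ _ (inj₁ l<l′) _ = l<l′
    monotone (l , m) (_ , m′) (inj₂ (refl , _)) p≁q = ⊥-elim (p≁q (∼F-column fin l m m′))

  IsQuotientMap : (T : LinOrder) → (P → Carrier T) → Set
  IsQuotientMap T f =
      (∀ t → Σ P λ p → f p ≡ t)
    × (∀ p q → (f p ≡ f q) ⇔ (p ∼F q))
    × (∀ p q → p <ₚ q → ¬ (p ∼F q) → LinOrder._<_ T (f p) (f q))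

  module QuotientMap {T : LinOrder} {f : P → Carrier T} (f-quot : IsQuotientMap T f) where
    private module T = Order T

    rep : Carrier T → P
    rep t = proj₁ (proj₁ f-quot t)

    rep-section : ∀ t → f (rep t) ≡ t
    rep-section t = proj₂ (proj₁ f-quot t)

    fibres : ∀ p q → (f p ≡ f q) ⇔ (p ∼F q)
    fibres = proj₁ (proj₂ f-quot)

    monotone : ∀ p q → p <ₚ q → ¬ (p ∼F q) → f p T.< f q
    monotone = proj₂ (proj₂ f-quot)

    separated : ∀ {p q} → f p T.< f q → ¬ p ∼F q
    separated {p} {q} fp<fq p∼q = T.irrefl (from (fibres p q) p∼q) fp<fq

    <⇔ : ∀ p q → f p T.< f q ⇔ (p <ₚ q × ¬ p ∼F q)
    <⇔ p q = mk⇔ reflects (λ (p<q , p≁q) → monotone p q p<q p≁q)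
      where
      reflects : f p T.< f q → p <ₚ q × ¬ p ∼F q
      reflects fp<fq with compareₚ p q
      ... | inj₁ p<q = p<q , separated fp<fq
      ... | inj₂ (inj₁ refl) = ⊥-elim (T.irrefl refl fp<fq)
      ... | inj₂ (inj₂ q<p) =
        ⊥-elim (T.asym fp<fq (monotone q p q<p (separated fp<fq ∘ ∼F-sym)))

  rep-∘-rep : ∀ {U V h k} (h-quot : IsQuotientMap U h) (k-quot : IsQuotientMap V k) →
              ∀ u → h (QuotientMap.rep {V} {k} k-quot (k (QuotientMap.rep {U} {h} h-quot u))) ≡ u
  rep-∘-rep {U} {V} {h} {k} h-quot k-quot u = begin
    h (K.rep (k p)) ≡⟨ from (H.fibres _ p) (to (K.fibres _ p) (K.rep-section (k p))) ⟩
    h p             ≡⟨ H.rep-section u ⟩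
    u               ∎
    where
    open ≡-Reasoning
    module H = QuotientMap {U} {h} h-quot
    module K = QuotientMap {V} {k} k-quot
    p = H.rep u

  ·F-unique : ∀ {S T} → QuotientIso S → QuotientIso T → S ≅ T
  ·F-unique {S} {T} (f , f-quot) (g , g-quot) =
    g ∘ F.rep , f ∘ G.rep ,
    rep-∘-rep {S} {T} {f} {g} f-quot g-quot , rep-∘-rep {T} {S} {g} {f} g-quot f-quot , <⇔
    where
    module F = QuotientMap {S} {f} f-quot
    module G = QuotientMap {T} {g} g-quot

    <⇔ : ∀ s s′ → LinOrder._<_ S s s′ ⇔ LinOrder._<_ T (g (F.rep s)) (g (F.rep s′))
    <⇔ s s′ with F.rep s | F.rep-section s | F.rep s′ | F.rep-section s′
    ... | p | refl | p′ | refl = ⇔-sym (G.<⇔ p p′) ⇔-∘ F.<⇔ p p′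

·F𝟙≅𝟙 : ∀ L → LocallyFinite L → Carrier L → L ·F 𝟙 ≅ 𝟙
·F𝟙≅𝟙 L fin l₀ = quotientIso-𝟙 (l₀ , tt) all∼F
  where
  open Lex L 𝟙
  all∼F : ∀ p q → p ∼F q
  all∼F (l , tt) (l′ , tt) with fin l l′
  ... | xs , covers = map (_, tt) xs , λ
    { (k , tt) (inj₁ (p , q)) → ∈-map⁺ (_, tt) (covers k (inj₁ (≤ₚ⇒≤₁ p , ≤ₚ⇒≤₁ q)))
    ; (k , tt) (inj₂ (p , q)) → ∈-map⁺ (_, tt) (covers k (inj₂ (≤ₚ⇒≤₁ p , ≤ₚ⇒≤₁ q))) }

𝟙·F≅𝟙 : ∀ M → LocallyFinite M → Carrier M → 𝟙 ·F M ≅ 𝟙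
𝟙·F≅𝟙 M fin m₀ = quotientIso-𝟙 (tt , m₀) λ { (tt , m) (tt , m′) → ∼F-column fin tt m m′ }
  where open Lex 𝟙 M

infixl 7 _∙_

_∙_ : R → R → R
_   ∙ one = one
one ∙ _   = one
X   ∙ _   = X

locallyFinite : ∀ X → LocallyFinite ⟦ X ⟧
locallyFinite one       = locallyFinite-𝟙
locallyFinite omega     = locallyFinite-ω
locallyFinite omegaStar = locallyFinite-ω*
locallyFinite zeta      = locallyFinite-ζ

point : ∀ X → Carrier ⟦ X ⟧
point one       = tt
point omega     = 0
point omegaStar = 0
point zeta      = + 0

·F≅left : ∀ X Y → InfiniteAbove ⟦ Y ⟧ ⊎ InfiniteBelow ⟦ Y ⟧ → ⟦ X ⟧ ·F ⟦ Y ⟧ ≅ ⟦ X ⟧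
·F≅left X Y infinite = Lex.quotientIso-left ⟦ X ⟧ ⟦ Y ⟧ (locallyFinite Y) infinite (point Y)

·F-table : ∀ X Y → ⟦ X ⟧ ·F ⟦ Y ⟧ ≅ ⟦ X ∙ Y ⟧
·F-table X         one       = ·F𝟙≅𝟙 ⟦ X ⟧ (locallyFinite X) (point X)
·F-table one       omega     = 𝟙·F≅𝟙 ω locallyFinite-ω 0
·F-table one       omegaStar = 𝟙·F≅𝟙 ω* locallyFinite-ω* 0
·F-table one       zeta      = 𝟙·F≅𝟙 ζ locallyFinite-ζ (+ 0)
·F-table omega     omega     = ·F≅left omega omega (inj₁ infiniteAbove-ω)
·F-table omega     omegaStar = ·F≅left omega omegaStar (inj₂ infiniteBelow-ω*)
·F-table omega     zeta      = ·F≅left omega zeta (inj₁ infiniteAbove-ζ)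
·F-table omegaStar omega     = ·F≅left omegaStar omega (inj₁ infiniteAbove-ω)
·F-table omegaStar omegaStar = ·F≅left omegaStar omegaStar (inj₂ infiniteBelow-ω*)
·F-table omegaStar zeta      = ·F≅left omegaStar zeta (inj₁ infiniteAbove-ζ)
·F-table zeta      omega     = ·F≅left zeta omega (inj₁ infiniteAbove-ω)
·F-table zeta      omegaStar = ·F≅left zeta omegaStar (inj₂ infiniteBelow-ω*)
·F-table zeta      zeta      = ·F≅left zeta zeta (inj₁ infiniteAbove-ζ)

hasMin? : ∀ X → Dec (HasMin ⟦ X ⟧)
hasMin? one       = yes min-𝟙
hasMin? omega     = yes min-ω
hasMin? omegaStar = no noMin-ω*
hasMin? zeta      = no noMin-ζ

hasMax? : ∀ X → Dec (HasMax ⟦ X ⟧)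
hasMax? one       = yes max-𝟙
hasMax? omega     = no noMax-ω
hasMax? omegaStar = yes max-ω*
hasMax? zeta      = no noMax-ζ

ends : R → Bool × Bool
ends X = does (hasMin? X) , does (hasMax? X)

fromEnds : Bool × Bool → R
fromEnds (true  , true)  = one
fromEnds (true  , false) = omega
fromEnds (false , true)  = omegaStar
fromEnds (false , false) = zeta

fromEnds∘ends : ∀ X → fromEnds (ends X) ≡ X
fromEnds∘ends one       = refl
fromEnds∘ends omega     = refl
fromEnds∘ends omegaStar = refl
fromEnds∘ends zeta      = refl

ends-injective : ∀ {X Y} → ends X ≡ ends Y → X ≡ Y
ends-injective {X} {Y} ends-X≡ends-Y = begin
  X                 ≡⟨ fromEnds∘ends X ⟨
  fromEnds (ends X) ≡⟨ cong fromEnds ends-X≡ends-Y ⟩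
  fromEnds (ends Y) ≡⟨ fromEnds∘ends Y ⟩
  Y                 ∎
  where open ≡-Reasoning

≅⇒≡ : ∀ {X Y} → ⟦ X ⟧ ≅ ⟦ Y ⟧ → X ≡ Y
≅⇒≡ {X} {Y} X≅Y = ends-injective (cong₂ _,_
  (does-⇔ (HasMin-cong {⟦ X ⟧} {⟦ Y ⟧} X≅Y) (hasMin? X) (hasMin? Y))
  (does-⇔ (HasMax-cong {⟦ X ⟧} {⟦ Y ⟧} X≅Y) (hasMax? X) (hasMax? Y)))

≡⇒≅ : ∀ {X Y} → X ≡ Y → ⟦ X ⟧ ≅ ⟦ Y ⟧
≡⇒≅ {X} refl = ≅-refl {⟦ X ⟧}

·F-determines : ∀ {X Y Z} → ⟦ X ⟧ ·F ⟦ Y ⟧ ≅ ⟦ Z ⟧ → Z ≡ X ∙ Y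
·F-determines {X} {Y} {Z} X·Y≅Z =
  ≅⇒≡ (Lex.·F-unique ⟦ X ⟧ ⟦ Y ⟧ {⟦ Z ⟧} {⟦ X ∙ Y ⟧} X·Y≅Z (·F-table X Y))

infix 4 _≟_

_≟_ : DecidableEquality R
X ≟ Y = map′ ends-injective (cong ends) (≡-dec Bool._≟_ Bool._≟_ (ends X) (ends Y))

∀? : {P : R → Set} → (∀ X → Dec (P X)) → Dec (∀ X → P X)
∀? P? = map′
  (λ { (p₁ , p₂ , p₃ , p₄) → λ { one → p₁ ; omega → p₂ ; omegaStar → p₃ ; zeta → p₄ } })
  (λ p → p one , p omega , p omegaStar , p zeta)
  (P? one ×-dec P? omega ×-dec P? omegaStar ×-dec P? zeta)

∙-assoc : Associative _∙_
∙-assoc = toWitness {a? = ∀? λ X → ∀? λ Y → ∀? λ Z → X ∙ Y ∙ Z ≟ X ∙ (Y ∙ Z)} _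

∙-idem : Idempotent _∙_
∙-idem = toWitness {a? = ∀? λ X → X ∙ X ≟ X} _

∙-leftRegular : ∀ X Y → X ∙ Y ∙ X ≡ X ∙ Y
∙-leftRegular = toWitness {a? = ∀? λ X → ∀? λ Y → X ∙ Y ∙ X ≟ X ∙ Y} _

mainTheorem1 :
    (∀ X Y → Σ R λ Z → ⟦ X ⟧ ·F ⟦ Y ⟧ ≅ ⟦ Z ⟧)
  × (∀ X Y Z U V W W′ →
       ⟦ X ⟧ ·F ⟦ Y ⟧ ≅ ⟦ U ⟧ → ⟦ U ⟧ ·F ⟦ Z ⟧ ≅ ⟦ W ⟧ →
       ⟦ Y ⟧ ·F ⟦ Z ⟧ ≅ ⟦ V ⟧ → ⟦ X ⟧ ·F ⟦ V ⟧ ≅ ⟦ W′ ⟧ →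
       ⟦ W ⟧ ≅ ⟦ W′ ⟧)
  × (∀ X → ⟦ X ⟧ ·F ⟦ X ⟧ ≅ ⟦ X ⟧)
  × (∀ X Y U W →
       ⟦ X ⟧ ·F ⟦ Y ⟧ ≅ ⟦ U ⟧ → ⟦ U ⟧ ·F ⟦ X ⟧ ≅ ⟦ W ⟧ →
       ⟦ W ⟧ ≅ ⟦ U ⟧)
mainTheorem1 =
    (λ X Y → X ∙ Y , ·F-table X Y)
  , (λ X Y Z U V W W′ XY≅U UZ≅W YZ≅V XV≅W′ → ≡⇒≅ {W} {W′} (begin
      W           ≡⟨ ·F-determines {U} {Z} UZ≅W ⟩
      U ∙ Z       ≡⟨ cong (_∙ Z) (·F-determines {X} {Y} XY≅U) ⟩
      X ∙ Y ∙ Z   ≡⟨ ∙-assoc X Y Z ⟩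
      X ∙ (Y ∙ Z) ≡⟨ cong (X ∙_) (·F-determines {Y} {Z} YZ≅V) ⟨
      X ∙ V       ≡⟨ ·F-determines {X} {V} XV≅W′ ⟨
      W′          ∎))
  , (λ X → subst (λ Z → ⟦ X ⟧ ·F ⟦ X ⟧ ≅ ⟦ Z ⟧) (∙-idem X) (·F-table X X))
  , (λ X Y U W XY≅U UX≅W → ≡⇒≅ {W} {U} (begin
      W         ≡⟨ ·F-determines {U} {X} UX≅W ⟩
      U ∙ X     ≡⟨ cong (_∙ X) (·F-determines {X} {Y} XY≅U) ⟩
      X ∙ Y ∙ X ≡⟨ ∙-leftRegular X Y ⟩
      X ∙ Y     ≡⟨ ·F-determines {X} {Y} XY≅U ⟨
      U         ∎))
  where open ≡-Reasoning
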